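{- Let $k\ge 1$ and $t_0,\dots,t_{k-1}$ be positive integers, and let $n\ge 1$. If there is no good palindromic partition of $\{1,\dots,n\}$ with respect to $(t_0,\dots,t_{k-1})$, then for every integer $i\ge 0$ there is no good palindromic partition of $\{1,\dots,n+2i\}$ with respect to $(t_0,\dots,t_{k-1})$.
   Context: An arithmetic progression of length $t$ is a set $\{a+id : i=0,\dots,t-1\}$ with $a,d$ positive integers. A good partition of $\{1,\dots,n\}$ with respect to $(t_0,\dots,t_{k-1})$ is a tuple $(P_0,\dots,P_{k-1})$ of pairwise disjoint (possibly empty) sets with union $\{1,\dots,n\}$ such that no $P_i$ contains an arithmetic progression of length $t_i$. It is palindromic if for every $v\in\{1,\dots,n\}$ and every $i$, $v\in P_i$ iff $n+1-v\in P_i$. -}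

module Defs where

open import Data.Nat using (ℕ; suc; _+_; _*_; _∸_; _≤_; _<_)
open import Data.Fin using (Fin)
open import Data.Product using (Σ; ∃; _×_)
open import Relation.Binary.PropositionalEquality using (_≡_)
open import Relation.Nullary using (¬_)

-- A partition (P_0,…,P_{k-1}) of {1,…,n} into pairwise disjoint, possibly
-- empty, sets covering {1,…,n} is represented by its class map
-- c : ℕ → Fin k, with P_i = { v ∈ {1,…,n} ∣ c v ≡ i }.  Values of c outside
-- {1,…,n} are irrelevant.
Colouring : ℕ → Set
Colouring k = ℕ → Fin k

InRange : ℕ → ℕ → Set
InRange n v = (1 ≤ v) × (v ≤ n)

ContainsAP : (n : ℕ) {k : ℕ} → Colouring k → Fin k → ℕ → Set
ContainsAP n c i t =
  Σ ℕ λ a → Σ ℕ λ d → (1 ≤ a) × (1 ≤ d) ×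
    ((j : ℕ) → j < t → InRange n (a + j * d) × (c (a + j * d) ≡ i))

Good : (n : ℕ) {k : ℕ} → (Fin k → ℕ) → Colouring k → Set
Good n t c = (i : Fin _) → ¬ ContainsAP n c i (t i)

Palindromic : (n : ℕ) {k : ℕ} → Colouring k → Set
Palindromic n c = (v : ℕ) → InRange n v → c v ≡ c (suc n ∸ v)

HasGoodPalindromic : (n : ℕ) {k : ℕ} → (Fin k → ℕ) → Set
HasGoodPalindromic n {k} t = Σ (Colouring k) λ c → Good n t c × Palindromic n c

-- Deleting the first i and the last i points of a good palindromic partition
-- of {1,…,n+2i} and relabelling v ↦ v − i yields a good palindromic partition
-- of {1,…,n}: arithmetic progressions in the middle block stay arithmetic
-- progressions, and the reflection v ↦ n+2i+1−v restricts to v ↦ n+1−v.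
module Submission where

open import Defs
open import Data.Nat using (ℕ; suc; _+_; _*_; _∸_; _≤_; _<_)
open import Data.Nat.Properties
  using (+-assoc; +-comm; +-suc; +-identityʳ; +-∸-comm; [m+n]∸[m+o]≡n∸o;
         m≤m+n; m≤n+m; +-monoʳ-≤; ≤-trans; n≤1+n)
open import Data.Fin using (Fin)
open import Data.Product using (_,_; _×_)
open import Relation.Nullary using (¬_)
open import Relation.Binary.PropositionalEquality
  using (_≡_; sym; trans; cong; subst; module ≡-Reasoning)

shift : ∀ {k} → ℕ → Colouring k → Colouring k
shift j c v = c (j + v)

InRange-shift : ∀ {m N v} j → j + m ≤ N → InRange m v → InRange N (j + v)
InRange-shift {v = v} j j+m≤N (1≤v , v≤m) =
  ≤-trans 1≤v (m≤n+m v j) , ≤-trans (+-monoʳ-≤ j v≤m) j+m≤N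

Good-shift : ∀ {k} {t : Fin k → ℕ} {c : Colouring k} {m N} j →
             j + m ≤ N → Good N t c → Good m t (shift j c)
Good-shift {t = t} {c} {N = N} j j+m≤N good i (a , d , 1≤a , 1≤d , ap) =
  good i (j + a , d , ≤-trans 1≤a (m≤n+m a j) , 1≤d , ap′)
  where
  ap′ : ∀ l → l < t i → InRange N (j + a + l * d) × (c (j + a + l * d) ≡ i)
  ap′ l l<t with ap l l<t
  ... | inRange , colour rewrite +-assoc j a (l * d) =
    InRange-shift j j+m≤N inRange , colour

reflect-shift : ∀ j m v → v ≤ suc m →
                suc (j + m + j) ∸ (j + v) ≡ j + (suc m ∸ v)
reflect-shift j m v v≤1+m = begin
  suc (j + m + j) ∸ (j + v)   ≡⟨ cong (_∸ (j + v)) outer ⟩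
  j + (suc m + j) ∸ (j + v)   ≡⟨ [m+n]∸[m+o]≡n∸o j (suc m + j) v ⟩
  suc m + j ∸ v               ≡⟨ +-∸-comm j v≤1+m ⟩
  suc m ∸ v + j               ≡⟨ +-comm (suc m ∸ v) j ⟩
  j + (suc m ∸ v)             ∎
  where
  open ≡-Reasoning
  outer : suc (j + m + j) ≡ j + (suc m + j)
  outer = trans (cong suc (+-assoc j m j)) (sym (+-suc j (m + j)))

Palindromic-shift : ∀ {k} {c : Colouring k} j m →
                    Palindromic (j + m + j) c → Palindromic m (shift j c)
Palindromic-shift {c = c} j m pal v inRange@(_ , v≤m) =
  trans (pal (j + v) (InRange-shift j (m≤m+n (j + m) j) inRange))
        (cong c (reflect-shift j m v (≤-trans v≤m (n≤1+n m))))

HasGoodPalindromic-trim : ∀ {k} (t : Fin k → ℕ) j m →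
                          HasGoodPalindromic (j + m + j) t → HasGoodPalindromic m t
HasGoodPalindromic-trim t j m (c , good , pal) =
  shift j c , Good-shift {c = c} j (m≤m+n (j + m) j) good , Palindromic-shift j m pal

corollary4p2 : (k : ℕ) → 1 ≤ k → (t : Fin k → ℕ) → ((i : Fin k) → 1 ≤ t i) →
    (n : ℕ) → 1 ≤ n → ¬ HasGoodPalindromic n t →
    (i : ℕ) → ¬ HasGoodPalindromic (n + 2 * i) t
corollary4p2 k _ t _ n _ none i partition =
  none (HasGoodPalindromic-trim t i n
         (subst (λ N → HasGoodPalindromic N t) n+2i≡i+n+i partition))
  where
  open ≡-Reasoning
  n+2i≡i+n+i : n + 2 * i ≡ i + n + i
  n+2i≡i+n+i = begin
    n + (i + (i + 0))   ≡⟨ cong (λ x → n + (i + x)) (+-identityʳ i) ⟩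
    n + (i + i)         ≡⟨ sym (+-assoc n i i) ⟩
    n + i + i           ≡⟨ cong (_+ i) (+-comm n i) ⟩
    i + n + i           ∎
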